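{- Let $k \geq 2$ be an integer and let $\ell > k$ be a prime. Suppose there are rational numbers $x, y$ with $y \neq 0$ such that $$x(x+1)\cdots(x+k-1) = y^\ell.$$ Let $p$ be a prime with $k/2 < p \leq k$. Then there exist non-zero integers $a, b, c, u, v, w$ satisfying $$a u^\ell + b v^\ell + c w^\ell = 0$$ such that: (i) each of $a$, $b$, $c$ is $\ell$-th power free (not divisible by the $\ell$-th power of any prime); (ii) every prime divisor of $abc$ is at most $k$; (iii) $p \nmid abc$; (iv) $p$ divides exactly one of $u$, $v$, $w$. -}

module Defs where

open import Data.Nat as ℕ using (ℕ; zero; suc)
open import Data.Nat.Primality using (Prime)
open import Data.Nat.Divisibility using (_∣_)
open import Data.Integer as ℤ using (ℤ; ∣_∣)
open import Data.Rational as ℚ using (ℚ; 1ℚ)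
open import Relation.Nullary using (¬_)

_^ℚ_ : ℚ → ℕ → ℚ
q ^ℚ zero  = 1ℚ
q ^ℚ suc n = q ℚ.* (q ^ℚ n)

risingProd : ℚ → ℕ → ℚ
risingProd x zero    = 1ℚ
risingProd x (suc k) = risingProd x k ℚ.* (x ℚ.+ (ℤ.+ k ℚ./ 1))

PowerFree : ℕ → ℤ → Set
PowerFree ℓ a = ∀ (q : ℕ) → Prime q → ¬ ((q ℕ.^ ℓ) ∣ ∣ a ∣)

PrimeDivisorsAtMost : ℕ → ℤ → Set
PrimeDivisorsAtMost k a = ∀ (q : ℕ) → Prime q → q ∣ ∣ a ∣ → q ℕ.≤ k

{-# OPTIONS --safe #-}
module Submission where

-- Write x = n / s in lowest terms, y = r / t and A i = n + i s, so that the hypothesis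
-- reads A 0 ⋯ A (k-1) · t^ℓ = r^ℓ · s^k. Every A i is prime to s, hence s^k = t^ℓ, so
-- s = D^ℓ as gcd(k, ℓ) = 1, and ∣A 0 ⋯ A (k-1)∣ = ∣r∣^ℓ. A prime dividing two terms
-- A i and A j divides i - j; so it is below k, and if it is p then ∣i - j∣ = p since
-- k < 2p. Write a term (or a product of terms) as an ℓ-th power free coefficient times
-- an ℓ-th power: every prime of the coefficient divides another term too, so it is
-- below k. If p divides s or at most one term, two consecutive terms give
-- A i - A (i+1) + D^ℓ = 0. Otherwise p divides exactly A i₀ and A (i₀+p) for some
-- i₀ < p, and A i₀ · A (i₀+p) - A (i₀+1) · A (i₀+p-1) + (p-1) · (D²)^ℓ = 0.

open import Defs
open import Data.Nat as ℕ using (ℕ; suc; _≤_; _<_)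
open import Data.Nat.Properties using (m^n≢0; <-trans)
open import Data.Nat.Primality using (Prime; prime⇒nonZero)
open import Data.Nat.Divisibility using (_∣_)
open import Data.Nat.Coprimality as Coprime using (Coprime; prime⇒coprime)
open import Data.Integer as ℤ using (ℤ; ∣_∣)
open import Data.Integer.Properties using (∣i∣≡0⇒i≡0)
open import Data.Rational using (ℚ; 0ℚ; mkℚ)
open import Data.Rational.Properties using (↥p≡0⇒p≡0)
open import Data.Product using (_×_; _,_; ∃-syntax)
open import Data.Sum using (_⊎_)
open import Relation.Nullary using (¬_)
open import Relation.Binary.PropositionalEquality using (_≡_; _≢_)

module NatFacts where

  open import Data.Nat.Base
  open import Data.Nat.Properties
  open import Data.Nat.Divisibility
  open import Data.Nat.Primality
  open import Data.Nat.Primality.Factorisation using (factorise)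
  open import Data.Nat.Coprimality using (Coprime; coprime-factors; coprime-divisor; coprime-Bézout)
  open import Data.Nat.GCD using (module Bézout)
  open import Data.Nat.Induction using (<-rec)
  open import Data.Nat.ListAction using (product)
  open import Data.Integer.Base using (+_)
  open import Data.List.Base using ([]; _∷_)
  open import Data.List.Relation.Unary.All using (_∷_)
  open import Data.Product.Base using (∃; ∃₂; _×_; _,_)
  open import Data.Sum.Base using (inj₁; inj₂)
  open import Function.Base using (_∘_)
  open import Relation.Nullary using (¬_; yes; no; _×-dec_)
  open import Relation.Nullary.Negation using (contradiction)
  open import Relation.Binary.PropositionalEquality
  open import Algebra.Properties.CommutativeSemigroup *-commutativeSemigroup using (interchange)

  private variable m n o p : ℕ

  prime>1 : Prime p → 1 < p
  prime>1 pp = nonTrivial⇒n>1 _ {{prime⇒nonTrivial pp}}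

  prime∤1 : Prime p → ¬ p ∣ 1
  prime∤1 pp p∣1 = <⇒≢ (prime>1 pp) (sym (∣1⇒≡1 p∣1))

  0^n≡0 : ∀ n .{{_ : NonZero n}} → 0 ^ n ≡ 0
  0^n≡0 (suc n) = refl

  m*m^[n∸1]≡m^n : ∀ m n .{{_ : NonZero n}} → m * m ^ (n ∸ 1) ≡ m ^ n
  m*m^[n∸1]≡m^n m (suc n) = refl

  n<2^n : ∀ n → n < 2 ^ n
  n<2^n zero    = s≤s z≤n
  n<2^n (suc n) = ≤-<-trans (n<2^n n) (m<m+n (2 ^ n) (≤-trans (m^n>0 2 n) (m≤m+n (2 ^ n) 0)))

  ^-distribʳ-* : ∀ m n o → (m * n) ^ o ≡ m ^ o * n ^ o
  ^-distribʳ-* m n zero    = refl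
  ^-distribʳ-* m n (suc o) = trans (cong (m * n *_) (^-distribʳ-* m n o)) (interchange m n (m ^ o) (n ^ o))

  ^-swap : ∀ m n o → (m ^ n) ^ o ≡ (m ^ o) ^ n
  ^-swap m n o = trans (^-*-assoc m n o) (trans (cong (m ^_) (*-comm n o)) (sym (^-*-assoc m o n)))

  ^-monoˡ-∣ : ∀ o → m ∣ n → m ^ o ∣ n ^ o
  ^-monoˡ-∣ {m} o (divides q refl) = divides (q ^ o) (^-distribʳ-* q m o)

  m∣m^n : ∀ m n .{{_ : NonZero n}} → m ∣ m ^ n
  m∣m^n m (suc n) = m∣m*n (m ^ n)

  prime∣^⇒∣ : Prime p → p ∣ m ^ n → p ∣ m
  prime∣^⇒∣ {n = zero}  pp p∣1 = contradiction p∣1 (prime∤1 pp)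
  prime∣^⇒∣ {m = m} {n = suc n} pp p∣m^n with euclidsLemma m (m ^ n) pp p∣m^n
  ... | inj₁ p∣m   = p∣m
  ... | inj₂ p∣m^n = prime∣^⇒∣ {n = n} pp p∣m^n

  ∣∧0<∧<2*⇒≡ : p ∣ m → 0 < m → m < 2 * p → m ≡ p
  ∣∧0<∧<2*⇒≡ (divides zero refl) () _
  ∣∧0<∧<2*⇒≡ {p} (divides (suc zero) refl) _ _ = +-identityʳ p
  ∣∧0<∧<2*⇒≡ {p} (divides (suc (suc c)) refl) _ m<2p = contradiction m<2p (≤⇒≯ (begin
    2 * p            ≡⟨ cong (_+_ p) (+-identityʳ p) ⟩
    p + p            ≤⟨ +-monoʳ-≤ p (m≤m+n p (c * p)) ⟩
    p + (p + c * p)  ∎))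
    where open ≤-Reasoning

  ∃prime∣ : .{{NonZero n}} → n ≢ 1 → ∃ λ q → Prime q × q ∣ n
  ∃prime∣ {n} n≢1 with factorise n
  ... | record { factors = [] ; isFactorisation = n≡1 } = contradiction n≡1 n≢1
  ... | record { factors = q ∷ qs ; isFactorisation = n≡q*qs ; factorsPrime = pq ∷ _ } =
    q , pq , subst (q ∣_) (sym n≡q*qs) (m∣m*n (product qs))

  coprime-*ˡ : Coprime m n → Coprime o n → Coprime (m * o) n
  coprime-*ˡ c₁ c₂ (d∣m*o , d∣n) = c₂ (coprime-factors c₁ (d∣m*o , ∣-trans d∣n (m∣m*n _)) , d∣n)

  coprime-^ˡ : ∀ o → Coprime m n → Coprime (m ^ o) n
  coprime-^ˡ zero    c (d∣1 , _) = ∣1⇒≡1 d∣1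
  coprime-^ˡ (suc o) c = coprime-*ˡ c (coprime-^ˡ o c)

  prime∤⇒coprime : Prime p → ¬ p ∣ n → Coprime p n
  prime∤⇒coprime pp p∤n (d∣p , d∣n) with prime⇒irreducible pp d∣p
  ... | inj₁ d≡1  = d≡1
  ... | inj₂ refl = contradiction d∣n p∤n

  ^∣^⇒∣ : ∀ ℓ .{{_ : NonZero ℓ}} m n → m ≢ 0 → m ^ ℓ ∣ n ^ ℓ → m ∣ n
  ^∣^⇒∣ ℓ = <-rec (λ m → ∀ n → m ≢ 0 → m ^ ℓ ∣ n ^ ℓ → m ∣ n) go
    where
    go : ∀ m → (∀ {m′} → m′ < m → ∀ n → m′ ≢ 0 → m′ ^ ℓ ∣ n ^ ℓ → m′ ∣ n) →
         ∀ n → m ≢ 0 → m ^ ℓ ∣ n ^ ℓ → m ∣ n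
    go m rec n m≢0 m^ℓ∣n^ℓ with m ≟ 1
    ... | yes refl = 1∣ n
    ... | no m≢1 with ∃prime∣ {{≢-nonZero m≢0}} m≢1
    ... | q , pq , q∣m with q∣m | prime∣^⇒∣ {n = ℓ} pq (∣-trans (∣-trans q∣m (m∣m^n m ℓ)) m^ℓ∣n^ℓ)
    ... | divides m′ refl | divides n′ refl = *-monoˡ-∣ q (rec m′<m n′ m′≢0 m′^ℓ∣n′^ℓ)
      where
      instance
        q≢0 : NonZero q
        q≢0 = prime⇒nonZero pq
      m′≢0 : m′ ≢ 0
      m′≢0 refl = m≢0 refl
      m′<m : m′ < m′ * q
      m′<m = m<m*n m′ q {{≢-nonZero m′≢0}} (prime>1 pq)
      m′^ℓ∣n′^ℓ : m′ ^ ℓ ∣ n′ ^ ℓ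
      m′^ℓ∣n′^ℓ = *-cancelʳ-∣ (q ^ ℓ) {{m^n≢0 q ℓ}}
                    (subst₂ _∣_ (^-distribʳ-* m′ q ℓ) (^-distribʳ-* n′ q ℓ) m^ℓ∣n^ℓ)

  *^≡^⇒∃^ : ∀ ℓ .{{_ : NonZero ℓ}} s m n → m ≢ 0 → s * m ^ ℓ ≡ n ^ ℓ → ∃ λ d → s ≡ d ^ ℓ
  *^≡^⇒∃^ ℓ s m n m≢0 s*m^ℓ≡n^ℓ with ^∣^⇒∣ ℓ m n m≢0 (divides s (sym s*m^ℓ≡n^ℓ))
  ... | divides d refl = d , *-cancelʳ-≡ s (d ^ ℓ) (m ^ ℓ) {{m^n≢0 m ℓ {{≢-nonZero m≢0}}}}
                               (trans s*m^ℓ≡n^ℓ (^-distribʳ-* d m ℓ))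

  ^≡^⇒∃^ : ∀ k ℓ .{{_ : NonZero ℓ}} s t → Coprime k ℓ → s ≢ 0 → t ≢ 0 →
           s ^ k ≡ t ^ ℓ → ∃ λ d → s ≡ d ^ ℓ
  ^≡^⇒∃^ k ℓ s t k⊥ℓ s≢0 t≢0 s^k≡t^ℓ with coprime-Bézout k⊥ℓ
  ... | Bézout.+- x y eq = *^≡^⇒∃^ ℓ s (s ^ y) (t ^ x) (s≢0 ∘ m^n≡0⇒m≡0 s y) (begin
    s * (s ^ y) ^ ℓ  ≡⟨ cong (s *_) (^-*-assoc s y ℓ) ⟩
    s ^ (1 + y * ℓ)  ≡⟨ cong (s ^_) eq ⟩
    s ^ (x * k)      ≡⟨ ^-*-assoc s x k ⟨
    (s ^ x) ^ k      ≡⟨ ^-swap s x k ⟩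
    (s ^ k) ^ x      ≡⟨ cong (_^ x) s^k≡t^ℓ ⟩
    (t ^ ℓ) ^ x      ≡⟨ ^-swap t ℓ x ⟩
    (t ^ x) ^ ℓ      ∎)
    where open ≡-Reasoning
  ... | Bézout.-+ x y eq = *^≡^⇒∃^ ℓ s (t ^ x) (s ^ y) (t≢0 ∘ m^n≡0⇒m≡0 t x) (begin
    s * (t ^ x) ^ ℓ  ≡⟨ cong (s *_) (^-swap t x ℓ) ⟩
    s * (t ^ ℓ) ^ x  ≡⟨ cong (λ z → s * z ^ x) s^k≡t^ℓ ⟨
    s * (s ^ k) ^ x  ≡⟨ cong (s *_) (^-*-assoc s k x) ⟩
    s ^ (1 + k * x)  ≡⟨ cong (λ z → s ^ (1 + z)) (*-comm k x) ⟩
    s ^ (1 + x * k)  ≡⟨ cong (s ^_) eq ⟩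
    s ^ (y * ℓ)      ≡⟨ ^-*-assoc s y ℓ ⟨
    (s ^ y) ^ ℓ      ∎)
    where open ≡-Reasoning

  -- Either some prime q has q^ℓ ∣ m, then q ∣ r and we recurse on m / q^ℓ and r / q,
  -- or m itself is ℓ-th power free.
  opaque
    powerFreeDecomposition : ∀ ℓ .{{_ : NonZero ℓ}} m n r → m ≢ 0 → m * n ≡ r ^ ℓ →
      ∃₂ λ a x → m ≡ a * x ^ ℓ × PowerFree ℓ (+ a) × (∀ q → Prime q → q ∣ a → q ∣ n)
    powerFreeDecomposition ℓ = <-rec _ go
      where
      Goal : ℕ → Set
      Goal m = ∀ n r → m ≢ 0 → m * n ≡ r ^ ℓ →
        ∃₂ λ a x → m ≡ a * x ^ ℓ × PowerFree ℓ (+ a) × (∀ q → Prime q → q ∣ a → q ∣ n)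

      go : ∀ m → (∀ {m′} → m′ < m → Goal m′) → Goal m
      go m rec n r m≢0 m*n≡r^ℓ with anyUpTo? (λ q → prime? q ×-dec q ^ ℓ ∣? m) (suc m)
      ... | yes (q , _ , pq , divides m′ refl) with prime∣^⇒∣ {n = ℓ} pq q∣r^ℓ
        where
        q∣r^ℓ : q ∣ r ^ ℓ
        q∣r^ℓ = subst (q ∣_) m*n≡r^ℓ (∣-trans (∣-trans (m∣m^n q ℓ) (n∣m*n m′)) (m∣m*n n))
      ... | divides r′ refl with rec m′<m n r′ m′≢0 m′*n≡r′^ℓ
        where
        instance
          q≢0 : NonZero q
          q≢0 = prime⇒nonZero pq
        m′≢0 : m′ ≢ 0
        m′≢0 refl = m≢0 refl
        m′<m : m′ < m′ * q ^ ℓ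
        m′<m = m<m*n m′ (q ^ ℓ) {{≢-nonZero m′≢0}} (<-≤-trans (prime>1 pq) (∣⇒≤ {{m^n≢0 q ℓ}} (m∣m^n q ℓ)))
        m′*n≡r′^ℓ : m′ * n ≡ r′ ^ ℓ
        m′*n≡r′^ℓ = *-cancelʳ-≡ (m′ * n) (r′ ^ ℓ) (q ^ ℓ) {{m^n≢0 q ℓ}} (begin
          m′ * n * q ^ ℓ    ≡⟨ *-assoc m′ n (q ^ ℓ) ⟩
          m′ * (n * q ^ ℓ)  ≡⟨ cong (m′ *_) (*-comm n (q ^ ℓ)) ⟩
          m′ * (q ^ ℓ * n)  ≡⟨ *-assoc m′ (q ^ ℓ) n ⟨
          m′ * q ^ ℓ * n    ≡⟨ m*n≡r^ℓ ⟩
          (r′ * q) ^ ℓ      ≡⟨ ^-distribʳ-* r′ q ℓ ⟩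
          r′ ^ ℓ * q ^ ℓ    ∎)
          where open ≡-Reasoning
      ... | a , x , m′≡a*x^ℓ , a-free , a∣n = a , x * q , m≡a*[x*q]^ℓ , a-free , a∣n
        where
        m≡a*[x*q]^ℓ : m′ * q ^ ℓ ≡ a * (x * q) ^ ℓ
        m≡a*[x*q]^ℓ = begin
          m′ * q ^ ℓ           ≡⟨ cong (_* q ^ ℓ) m′≡a*x^ℓ ⟩
          a * x ^ ℓ * q ^ ℓ    ≡⟨ *-assoc a (x ^ ℓ) (q ^ ℓ) ⟩
          a * (x ^ ℓ * q ^ ℓ)  ≡⟨ cong (a *_) (^-distribʳ-* x q ℓ) ⟨
          a * (x * q) ^ ℓ      ∎
          where open ≡-Reasoning
      go m rec n r m≢0 m*n≡r^ℓ | no ∄q = m , 1 , m≡m*1^ℓ , m-free , m∣n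
        where
        m≡m*1^ℓ : m ≡ m * 1 ^ ℓ
        m≡m*1^ℓ = sym (trans (cong (m *_) (^-zeroˡ ℓ)) (*-identityʳ m))
        m-free : PowerFree ℓ (+ m)
        m-free q pq q^ℓ∣m = ∄q (q , s≤s q≤m , pq , q^ℓ∣m)
          where
          instance
            q≢0 : NonZero q
            q≢0 = prime⇒nonZero pq
          q≤m : q ≤ m
          q≤m = ≤-trans (∣⇒≤ {{m^n≢0 q ℓ}} (m∣m^n q ℓ)) (∣⇒≤ {{≢-nonZero m≢0}} q^ℓ∣m)
        m∣n : ∀ q → Prime q → q ∣ m → q ∣ n
        m∣n q pq q∣m with q ∣? n
        ... | yes q∣n = q∣n
        ... | no  q∤n = contradiction q^ℓ∣m (m-free q pq)
          where
          q^ℓ∣n*m : q ^ ℓ ∣ n * m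
          q^ℓ∣n*m = subst (q ^ ℓ ∣_) (trans (sym m*n≡r^ℓ) (*-comm m n))
                      (^-monoˡ-∣ ℓ (prime∣^⇒∣ {n = ℓ} pq (subst (q ∣_) m*n≡r^ℓ (∣-trans q∣m (m∣m*n n)))))
          q^ℓ∣m : q ^ ℓ ∣ m
          q^ℓ∣m = coprime-divisor (coprime-^ˡ ℓ (prime∤⇒coprime pq q∤n)) q^ℓ∣n*m

module IntFacts where

  open import Data.Nat.Base as ℕ using (ℕ; zero; suc)
  import Data.Nat.Properties as ℕ
  open import Data.Nat.Divisibility using (_∣_; ∣-trans; m∣m*n; n∣m*n)
  open import Data.Nat.Primality using (Prime; euclidsLemma)
  open import Data.Integer.Base hiding (NonZero)
  open import Data.Integer.Properties
  import Data.Sign.Base as Sign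
  import Data.Sign.Properties as Sign
  open import Data.Product.Base using (_,_)
  open import Data.Sum.Base using (_⊎_; inj₁; inj₂; [_,_]′)
  open import Function.Base using (_∘′_)
  open import Relation.Nullary using (¬_)
  open import Relation.Nullary.Negation using (contradiction)
  open import Relation.Binary.PropositionalEquality
  open import Algebra.Properties.CommutativeSemigroup *-commutativeSemigroup using (interchange)
  open NatFacts using (powerFreeDecomposition; m∣m^n; prime∣^⇒∣; 0^n≡0; m*m^[n∸1]≡m^n)

  private variable q : ℕ

  abs-^ : ∀ i n → ∣ i ^ n ∣ ≡ ∣ i ∣ ℕ.^ n
  abs-^ i zero    = refl
  abs-^ i (suc n) = trans (abs-* i (i ^ n)) (cong (∣ i ∣ ℕ.*_) (abs-^ i n))

  pos-^ : ∀ m n → + (m ℕ.^ n) ≡ (+ m) ^ n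
  pos-^ m zero    = refl
  pos-^ m (suc n) = trans (pos-* m (m ℕ.^ n)) (cong ((+ m) *_) (pos-^ m n))

  ^-distribʳ-* : ∀ i j n → (i * j) ^ n ≡ i ^ n * j ^ n
  ^-distribʳ-* i j zero    = refl
  ^-distribʳ-* i j (suc n) = trans (cong (i * j *_) (^-distribʳ-* i j n)) (interchange i j (i ^ n) (j ^ n))

  *-≢0 : ∀ {i j} → i ≢ 0ℤ → j ≢ 0ℤ → i * j ≢ 0ℤ
  *-≢0 {i} i≢0 j≢0 i*j≡0 = [ i≢0 , j≢0 ]′ (i*j≡0⇒i≡0∨j≡0 i i*j≡0)

  prime∣∣*∣ : Prime q → ∀ i j → q ∣ ∣ i * j ∣ → (q ∣ ∣ i ∣) ⊎ (q ∣ ∣ j ∣)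
  prime∣∣*∣ pq i j q∣i*j = euclidsLemma ∣ i ∣ ∣ j ∣ pq (subst (_ ∣_) (abs-* i j) q∣i*j)

  record PowerFreeForm (ℓ : ℕ) (M : ℤ) (N : ℕ) : Set where
    field
      coeff base      : ℤ
      M≡coeff*base^ℓ : M ≡ coeff * base ^ ℓ
      coeff≢0         : coeff ≢ 0ℤ
      base≢0          : base ≢ 0ℤ
      powerFree       : PowerFree ℓ coeff
      coeff∣⇒∣N       : ∀ q → Prime q → q ∣ ∣ coeff ∣ → q ∣ N

    ∣M∣≡ : ∣ M ∣ ≡ ∣ coeff ∣ ℕ.* ∣ base ∣ ℕ.^ ℓ
    ∣M∣≡ = trans (cong ∣_∣ M≡coeff*base^ℓ) (trans (abs-* coeff (base ^ ℓ)) (cong (∣ coeff ∣ ℕ.*_) (abs-^ base ℓ)))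

    ∣coeff⇒∣M : ∀ {d} → d ∣ ∣ coeff ∣ → d ∣ ∣ M ∣
    ∣coeff⇒∣M d∣coeff = subst (_ ∣_) (sym ∣M∣≡) (∣-trans d∣coeff (m∣m*n _))

    ∣base⇒∣M : .{{ℕ.NonZero ℓ}} → ∀ {d} → d ∣ ∣ base ∣ → d ∣ ∣ M ∣
    ∣base⇒∣M d∣base = subst (_ ∣_) (sym ∣M∣≡) (∣-trans (∣-trans d∣base (m∣m^n ∣ base ∣ ℓ)) (n∣m*n ∣ coeff ∣))

    prime∣M∤coeff⇒∣base : Prime q → q ∣ ∣ M ∣ → ¬ q ∣ ∣ coeff ∣ → q ∣ ∣ base ∣
    prime∣M∤coeff⇒∣base pq q∣M q∤coeff with euclidsLemma ∣ coeff ∣ _ pq (subst (_ ∣_) ∣M∣≡ q∣M)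
    ... | inj₁ q∣coeff  = contradiction q∣coeff q∤coeff
    ... | inj₂ q∣base^ℓ = prime∣^⇒∣ {n = ℓ} pq q∣base^ℓ

  opaque
    powerFreeForm : ∀ ℓ .{{_ : ℕ.NonZero ℓ}} M N R → M ≢ 0ℤ → ∣ M ∣ ℕ.* N ≡ R ℕ.^ ℓ → PowerFreeForm ℓ M N
    powerFreeForm ℓ M N R M≢0 ∣M∣*N≡R^ℓ
      with powerFreeDecomposition ℓ ∣ M ∣ N R (M≢0 ∘′ ∣i∣≡0⇒i≡0) ∣M∣*N≡R^ℓ
    ... | a , x , ∣M∣≡a*x^ℓ , a-free , a∣N = record
      { coeff          = sign M ◃ a
      ; base           = + x
      ; M≡coeff*base^ℓ = M≡
      ; coeff≢0        = λ eq → a≢0 (trans (sym (abs-◃ (sign M) a)) (cong ∣_∣ eq))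
      ; base≢0         = λ eq → x≢0 (cong ∣_∣ eq)
      ; powerFree      = λ q pq → subst (λ m → ¬ q ℕ.^ ℓ ∣ m) (sym (abs-◃ (sign M) a)) (a-free q pq)
      ; coeff∣⇒∣N      = λ q pq → a∣N q pq ∘′ subst (q ∣_) (abs-◃ (sign M) a)
      }
      where
      a≢0 : a ≢ 0
      a≢0 refl = M≢0 (∣i∣≡0⇒i≡0 ∣M∣≡a*x^ℓ)
      x≢0 : x ≢ 0
      x≢0 refl = M≢0 (∣i∣≡0⇒i≡0 (trans ∣M∣≡a*x^ℓ (trans (cong (a ℕ.*_) (0^n≡0 ℓ)) (ℕ.*-zeroʳ a))))
      M≡ : M ≡ (sign M ◃ a) * (+ x) ^ ℓ
      M≡ = begin
        M                                         ≡⟨ ◃-inverse M ⟨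
        sign M ◃ ∣ M ∣                            ≡⟨ cong (sign M ◃_) ∣M∣≡a*x^ℓ ⟩
        sign M ◃ (a ℕ.* x ℕ.^ ℓ)                  ≡⟨ cong (_◃ (a ℕ.* x ℕ.^ ℓ)) (Sign.*-identityʳ (sign M)) ⟨
        (sign M Sign.* Sign.+) ◃ (a ℕ.* x ℕ.^ ℓ)  ≡⟨ ◃-distrib-* (sign M) Sign.+ a (x ℕ.^ ℓ) ⟩
        (sign M ◃ a) * (Sign.+ ◃ x ℕ.^ ℓ)         ≡⟨ cong ((sign M ◃ a) *_) (trans (+◃n≡+n _) (pos-^ x ℓ)) ⟩
        (sign M ◃ a) * (+ x) ^ ℓ                  ∎
        where open ≡-Reasoning

    *-powerFreeForm : ∀ {ℓ} .{{_ : ℕ.NonZero ℓ}} {M₁ M₂ N₁ N₂}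
                      (F₁ : PowerFreeForm ℓ M₁ N₁) (F₂ : PowerFreeForm ℓ M₂ N₂) →
                      PowerFreeForm ℓ (M₁ * M₂) ∣ PowerFreeForm.coeff F₁ * PowerFreeForm.coeff F₂ ∣
    *-powerFreeForm {ℓ} {M₁} {M₂} F₁ F₂ = record
      { coeff          = G.coeff
      ; base           = G.base * (F₁.base * F₂.base)
      ; M≡coeff*base^ℓ = M₁*M₂≡
      ; coeff≢0        = G.coeff≢0
      ; base≢0         = *-≢0 G.base≢0 (*-≢0 F₁.base≢0 F₂.base≢0)
      ; powerFree      = G.powerFree
      ; coeff∣⇒∣N      = λ q pq q∣coeff → prime∣^⇒∣ {n = ℓ ℕ.∸ 1} pq (G.coeff∣⇒∣N q pq q∣coeff)
      }
      where
      module F₁ = PowerFreeForm F₁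
      module F₂ = PowerFreeForm F₂
      C : ℤ
      C = F₁.coeff * F₂.coeff
      G : PowerFreeForm ℓ C (∣ C ∣ ℕ.^ (ℓ ℕ.∸ 1))
      G = powerFreeForm ℓ C (∣ C ∣ ℕ.^ (ℓ ℕ.∸ 1)) ∣ C ∣ (*-≢0 F₁.coeff≢0 F₂.coeff≢0) (m*m^[n∸1]≡m^n ∣ C ∣ ℓ)
      module G = PowerFreeForm G
      M₁*M₂≡ : M₁ * M₂ ≡ G.coeff * (G.base * (F₁.base * F₂.base)) ^ ℓ
      M₁*M₂≡ = begin
        M₁ * M₂                                            ≡⟨ cong₂ _*_ F₁.M≡coeff*base^ℓ F₂.M≡coeff*base^ℓ ⟩
        F₁.coeff * F₁.base ^ ℓ * (F₂.coeff * F₂.base ^ ℓ)  ≡⟨ interchange F₁.coeff (F₁.base ^ ℓ) F₂.coeff (F₂.base ^ ℓ) ⟩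
        C * (F₁.base ^ ℓ * F₂.base ^ ℓ)                    ≡⟨ cong₂ _*_ G.M≡coeff*base^ℓ (sym (^-distribʳ-* F₁.base F₂.base ℓ)) ⟩
        G.coeff * G.base ^ ℓ * (F₁.base * F₂.base) ^ ℓ     ≡⟨ *-assoc G.coeff _ _ ⟩
        G.coeff * (G.base ^ ℓ * (F₁.base * F₂.base) ^ ℓ)   ≡⟨ cong (G.coeff *_) (^-distribʳ-* G.base _ ℓ) ⟨
        G.coeff * (G.base * (F₁.base * F₂.base)) ^ ℓ       ∎
        where open ≡-Reasoning

module Products where

  open import Data.Nat.Base as ℕ using (ℕ; zero; suc; _<_)
  import Data.Nat.Properties as ℕ
  open import Data.Nat.Divisibility as ℕ using (_∣_)
  open import Data.Nat.Primality using (Prime; euclidsLemma; prime⇒nonZero)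
  open import Data.Nat.Coprimality using (Coprime; coprime-Bézout)
  open import Data.Nat.GCD using (module Bézout)
  open import Data.Integer.Base hiding (_≤_; _<_; NonZero)
  open import Data.Integer.Properties using (abs-*; pos-*; pos-+; *-identityʳ; *-assoc; *-comm)
  open import Data.Integer.Divisibility.Signed as Signed
    using (∣ᵤ⇒∣; ∣⇒∣ᵤ; ∣m∣n⇒∣m-n; ∣n⇒∣m*n; ∣m⇒∣m*n; divides)
  open import Data.Integer.DivMod using (_%ℕ_; _/ℕ_; a≡a%ℕn+[a/ℕn]*n; n%ℕd<d)
  open import Data.Integer.Tactic.RingSolver using (solve-∀)
  open import Data.Product.Base using (∃; _×_; _,_)
  open import Data.Sum.Base using (inj₁; inj₂)
  open import Function.Base using (_∘_)
  open import Relation.Nullary using (¬_; yes; no)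
  open import Relation.Nullary.Negation using (contradiction)
  open import Relation.Binary.PropositionalEquality
  open NatFacts using (prime>1; prime∤1; coprime-*ˡ; prime∤⇒coprime)
  open IntFacts using (prime∣∣*∣)

  private variable q k i : ℕ

  ∏ : ℕ → (ℕ → ℤ) → ℤ
  ∏ zero    f = 1ℤ
  ∏ (suc k) f = ∏ k f * f k

  -- progression n s i is the numerator of n / s + i.
  progression : ℤ → ℕ → ℕ → ℤ
  progression n s i = n + + i * + s

  without : (ℕ → ℤ) → ℕ → ℕ → ℤ
  without f i j with j ℕ.≟ i
  ... | yes _ = 1ℤ
  ... | no  _ = f j

  without-≢ : ∀ f {i j} → j ≢ i → without f i j ≡ f j
  without-≢ f {i} {j} j≢i with j ℕ.≟ i
  ... | yes j≡i = contradiction j≡i j≢i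
  ... | no  _   = refl

  without-≡ : ∀ f i → without f i i ≡ 1ℤ
  without-≡ f i with i ℕ.≟ i
  ... | yes _   = refl
  ... | no  i≢i = contradiction refl i≢i

  ∏-cong : ∀ k {f g} → (∀ {j} → j < k → f j ≡ g j) → ∏ k f ≡ ∏ k g
  ∏-cong zero    f≗g = refl
  ∏-cong (suc k) f≗g = cong₂ _*_ (∏-cong k (f≗g ∘ ℕ.m<n⇒m<1+n)) (f≗g (ℕ.n<1+n k))

  ∏-without : ∀ f → i < k → ∏ k f ≡ f i * ∏ k (without f i)
  ∏-without {i} {suc k} f i<1+k with ℕ.m≤n⇒m<n∨m≡n (ℕ.s≤s⁻¹ i<1+k)
  ... | inj₁ i<k = begin
    ∏ k f * f k                                ≡⟨ cong (_* f k) (∏-without f i<k) ⟩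
    f i * ∏ k (without f i) * f k              ≡⟨ *-assoc (f i) _ _ ⟩
    f i * (∏ k (without f i) * f k)            ≡⟨ cong (λ x → f i * (∏ k (without f i) * x)) (without-≢ f (ℕ.>⇒≢ i<k)) ⟨
    f i * (∏ k (without f i) * without f i k)  ∎
    where open ≡-Reasoning
  ... | inj₂ refl = begin
    ∏ k f * f k                                ≡⟨ *-comm (∏ k f) (f k) ⟩
    f k * ∏ k f                                ≡⟨ cong (f k *_) (∏-cong k (λ j<k → sym (without-≢ f (ℕ.<⇒≢ j<k)))) ⟩
    f k * ∏ k (without f k)                    ≡⟨ cong (f k *_) (*-identityʳ _) ⟨
    f k * (∏ k (without f k) * 1ℤ)             ≡⟨ cong (λ x → f k * (∏ k (without f k) * x)) (without-≡ f k) ⟨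
    f k * (∏ k (without f k) * without f k k)  ∎
    where open ≡-Reasoning

  ∏-without² : ∀ f {i j} → i < k → j < k → j ≢ i → ∏ k f ≡ f i * f j * ∏ k (without (without f i) j)
  ∏-without² {k} f {i} {j} i<k j<k j≢i = begin
    ∏ k f                                                  ≡⟨ ∏-without f i<k ⟩
    f i * ∏ k (without f i)                                ≡⟨ cong (f i *_) (∏-without (without f i) j<k) ⟩
    f i * (without f i j * ∏ k (without (without f i) j))  ≡⟨ cong (λ x → f i * (x * ∏ k (without (without f i) j))) (without-≢ f j≢i) ⟩
    f i * (f j * ∏ k (without (without f i) j))            ≡⟨ *-assoc (f i) (f j) _ ⟨
    f i * f j * ∏ k (without (without f i) j)              ∎
    where open ≡-Reasoning

  prime∣∏⇒ : Prime q → ∀ k f → q ∣ ∣ ∏ k f ∣ → ∃ λ j → j < k × q ∣ ∣ f j ∣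
  prime∣∏⇒ pq zero    f q∣1 = contradiction q∣1 (prime∤1 pq)
  prime∣∏⇒ pq (suc k) f q∣∏ with prime∣∣*∣ pq (∏ k f) (f k) q∣∏
  ... | inj₂ q∣fk = k , ℕ.n<1+n k , q∣fk
  ... | inj₁ q∣∏k with prime∣∏⇒ pq k f q∣∏k
  ...   | j , j<k , q∣fj = j , ℕ.m<n⇒m<1+n j<k , q∣fj

  prime∣without⇒ : Prime q → ∀ f i j → q ∣ ∣ without f i j ∣ → j ≢ i × q ∣ ∣ f j ∣
  prime∣without⇒ pq f i j q∣fj with j ℕ.≟ i
  ... | yes _   = contradiction q∣fj (prime∤1 pq)
  ... | no  j≢i = j≢i , q∣fj

  prime∣∏without⇒ : Prime q → ∀ k f i → q ∣ ∣ ∏ k (without f i) ∣ → ∃ λ j → j < k × j ≢ i × q ∣ ∣ f j ∣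
  prime∣∏without⇒ pq k f i q∣∏ with prime∣∏⇒ pq k (without f i) q∣∏
  ... | j , j<k , q∣fj = j , j<k , prime∣without⇒ pq f i j q∣fj

  coprime-∏ : ∀ {s} k f → (∀ {j} → j < k → Coprime ∣ f j ∣ s) → Coprime ∣ ∏ k f ∣ s
  coprime-∏ zero    f _   (d∣1 , _) = ℕ.∣1⇒≡1 d∣1
  coprime-∏ (suc k) f f⊥s = subst (λ m → Coprime m _) (sym (abs-* (∏ k f) (f k)))
    (coprime-*ˡ (coprime-∏ k f (f⊥s ∘ ℕ.m<n⇒m<1+n)) (f⊥s (ℕ.n<1+n k)))

  pos-1+*≡* : ∀ a b c d → 1 ℕ.+ a ℕ.* b ≡ c ℕ.* d → 1ℤ + + a * + b ≡ + c * + d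
  pos-1+*≡* a b c d eq =
    trans (cong (_+_ 1ℤ) (sym (pos-* a b))) (trans (sym (pos-+ 1 (a ℕ.* b))) (trans (cong +_ eq) (pos-* c d)))

  ∃inverse-mod : ∀ {p s} → Coprime p s → ∃ λ c → + p Signed.∣ 1ℤ + c * + s
  ∃inverse-mod {p} {s} p⊥s with coprime-Bézout p⊥s
  ... | Bézout.+- x y eq = + y , divides (+ x) (pos-1+*≡* y s x p eq)
  ... | Bézout.-+ x y eq = - + y , divides (- + x) (begin
    1ℤ + - + y * + s       ≡⟨ lemma₁ (+ y) (+ s) ⟩
    1ℤ - + y * + s         ≡⟨ cong (_-_ 1ℤ) (pos-1+*≡* x p y s eq) ⟨
    1ℤ - (1ℤ + + x * + p)  ≡⟨ lemma₂ (+ x) (+ p) ⟩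
    - + x * + p            ∎)
    where
    open ≡-Reasoning
    lemma₁ : ∀ y s → 1ℤ + - y * s ≡ 1ℤ - y * s
    lemma₁ = solve-∀
    lemma₂ : ∀ x p → 1ℤ - (1ℤ + x * p) ≡ - x * p
    lemma₂ = solve-∀

  module _ (n : ℤ) (s : ℕ) where

    private
      A : ℕ → ℤ
      A = progression n s

    coprime-progression : Coprime ∣ n ∣ s → ∀ i → Coprime ∣ A i ∣ s
    coprime-progression n⊥s i {d} (d∣Ai , d∣s) = n⊥s (∣⇒∣ᵤ d∣n , d∣s)
      where
      lemma : ∀ n i s → n + i * s - i * s ≡ n
      lemma = solve-∀
      d∣n : + d Signed.∣ n
      d∣n = subst (+ d Signed.∣_) (lemma n (+ i) (+ s))
              (∣m∣n⇒∣m-n (∣ᵤ⇒∣ {+ d} {A i} d∣Ai) (∣n⇒∣m*n (+ i) (∣ᵤ⇒∣ {+ d} {+ s} d∣s)))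

    prime∣A[i]∣A[i+δ]⇒∣δ : Coprime ∣ n ∣ s → Prime q → ∀ i δ → q ∣ ∣ A i ∣ → q ∣ ∣ A (i ℕ.+ δ) ∣ → q ∣ δ
    prime∣A[i]∣A[i+δ]⇒∣δ {q} n⊥s pq i δ q∣Ai q∣Ai+δ with euclidsLemma δ s pq q∣δ*s
      where
      lemma : ∀ n i δ s → n + (i + δ) * s - (n + i * s) ≡ δ * s
      lemma = solve-∀
      Ai+δ-Ai≡δ*s : A (i ℕ.+ δ) - A i ≡ + δ * + s
      Ai+δ-Ai≡δ*s = trans (cong (λ x → n + x * + s - A i) (pos-+ i δ)) (lemma n (+ i) (+ δ) (+ s))
      q∣δ*s : q ∣ δ ℕ.* s
      q∣δ*s = subst (q ∣_) (abs-* (+ δ) (+ s)) (∣⇒∣ᵤ (subst (+ q Signed.∣_) Ai+δ-Ai≡δ*s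
                (∣m∣n⇒∣m-n (∣ᵤ⇒∣ {+ q} {A (i ℕ.+ δ)} q∣Ai+δ) (∣ᵤ⇒∣ {+ q} {A i} q∣Ai))))
    ... | inj₁ q∣δ = q∣δ
    ... | inj₂ q∣s = contradiction (coprime-progression n⊥s i (q∣Ai , q∣s)) (ℕ.<⇒≢ (prime>1 pq) ∘ sym)

    -- With p ∣ 1 + c s, the index i = n c mod p gives A i ≡ n (1 + c s) ≡ 0 (mod p).
    progression-hits-multiple : ∀ {p} → Prime p → ¬ p ∣ s → ∃ λ i → i < p × p ∣ ∣ A i ∣
    progression-hits-multiple {p} pp p∤s with ∃inverse-mod (prime∤⇒coprime pp p∤s)
    ... | c , divides w 1+cs≡wp = i₀ , n%ℕd<d (n * c) p , ∣⇒∣ᵤ (subst (+ p Signed.∣_) (sym Ai₀≡) p∣Ai₀)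
      where
      instance
        p≢0 : ℕ.NonZero p
        p≢0 = prime⇒nonZero pp
      i₀ : ℕ
      i₀ = (n * c) %ℕ p
      Q : ℤ
      Q = (n * c) /ℕ p
      lemma₁ : ∀ n i Q p s → n + i * s ≡ n + (i + Q * p) * s - Q * p * s
      lemma₁ = solve-∀
      lemma₂ : ∀ n c Q p s → n + n * c * s - Q * p * s ≡ n * (1ℤ + c * s) - Q * p * s
      lemma₂ = solve-∀
      Ai₀≡ : A i₀ ≡ n * (1ℤ + c * + s) - Q * + p * + s
      Ai₀≡ = begin
        n + + i₀ * + s                              ≡⟨ lemma₁ n (+ i₀) Q (+ p) (+ s) ⟩
        n + (+ i₀ + Q * + p) * + s - Q * + p * + s  ≡⟨ cong (λ z → n + z * + s - Q * + p * + s) (a≡a%ℕn+[a/ℕn]*n (n * c) p) ⟨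
        n + n * c * + s - Q * + p * + s             ≡⟨ lemma₂ n c Q (+ p) (+ s) ⟩
        n * (1ℤ + c * + s) - Q * + p * + s          ∎
        where open ≡-Reasoning
      p∣Ai₀ : + p Signed.∣ n * (1ℤ + c * + s) - Q * + p * + s
      p∣Ai₀ = ∣m∣n⇒∣m-n (∣n⇒∣m*n n (divides w 1+cs≡wp)) (∣m⇒∣m*n (+ s) (∣n⇒∣m*n Q Signed.∣-refl))

module ClearDenominators where

  open import Data.Nat.Base as ℕ using (ℕ; zero; suc)
  import Data.Nat.Properties as ℕ
  open import Data.Nat.Coprimality as Coprime using (Coprime; coprime-divisor)
  open import Data.Nat.Divisibility using (_∣_; ∣1⇒≡1; ∣-antisym; divides)
  open import Data.Integer.Base as ℤ using (ℤ; +_; ∣_∣)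
  import Data.Integer.Properties as ℤ
  open import Data.Rational.Base as ℚ using (ℚ; mkℚ)
  open import Data.Rational.Properties using (toℚᵘ-homo-*; toℚᵘ-homo-+; normalize-coprime)
  open import Data.Rational.Unnormalised.Base as ℚᵘ using (ℚᵘ; mkℚᵘ; _≃_; *≡*; ↥_; ↧_)
  open import Data.Rational.Unnormalised.Properties as ℚᵘ using (≃-trans; ≃-sym; ≃-refl; ≃-reflexive)
  open import Data.Product.Base using (_×_; _,_)
  open import Relation.Binary.PropositionalEquality
  open NatFacts using (coprime-^ˡ)
  open IntFacts using (abs-^)
  open Products using (∏; progression; coprime-∏; coprime-progression)

  risingProdᵘ : ℚᵘ → ℕ → ℚᵘ
  risingProdᵘ x zero    = ℚᵘ.1ℚᵘ
  risingProdᵘ x (suc k) = risingProdᵘ x k ℚᵘ.* (x ℚᵘ.+ mkℚᵘ (+ k) 0)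

  _^ᵘ_ : ℚᵘ → ℕ → ℚᵘ
  x ^ᵘ zero  = ℚᵘ.1ℚᵘ
  x ^ᵘ suc k = x ℚᵘ.* x ^ᵘ k

  toℚᵘ-risingProd : ∀ x k → ℚ.toℚᵘ (risingProd x k) ≃ risingProdᵘ (ℚ.toℚᵘ x) k
  toℚᵘ-risingProd x zero    = ≃-refl
  toℚᵘ-risingProd x (suc k) =
    ≃-trans (toℚᵘ-homo-* (risingProd x k) (x ℚ.+ (+ k ℚ./ 1)))
      (ℚᵘ.*-cong (toℚᵘ-risingProd x k)
        (≃-trans (toℚᵘ-homo-+ x (+ k ℚ./ 1)) (ℚᵘ.+-congʳ (ℚ.toℚᵘ x) (≃-reflexive k/1≡k))))
    where
    k/1≡k : ℚ.toℚᵘ (+ k ℚ./ 1) ≡ mkℚᵘ (+ k) 0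
    k/1≡k = cong ℚ.toℚᵘ (normalize-coprime {k} {0} λ (_ , d∣1) → ∣1⇒≡1 d∣1)

  toℚᵘ-^ℚ : ∀ x k → ℚ.toℚᵘ (x ^ℚ k) ≃ ℚ.toℚᵘ x ^ᵘ k
  toℚᵘ-^ℚ x zero    = ≃-refl
  toℚᵘ-^ℚ x (suc k) = ≃-trans (toℚᵘ-homo-* x (x ^ℚ k)) (ℚᵘ.*-congˡ {ℚ.toℚᵘ x} (toℚᵘ-^ℚ x k))

  ↥-* : ∀ x y → ↥ (x ℚᵘ.* y) ≡ ↥ x ℤ.* ↥ y
  ↥-* (mkℚᵘ _ _) (mkℚᵘ _ _) = refl

  ↧-* : ∀ x y → ↧ (x ℚᵘ.* y) ≡ ↧ x ℤ.* ↧ y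
  ↧-* (mkℚᵘ _ a) (mkℚᵘ _ b) = sym (ℤ.pos-* (suc a) (suc b))

  ↥-^ᵘ : ∀ x k → ↥ (x ^ᵘ k) ≡ ↥ x ℤ.^ k
  ↥-^ᵘ x zero    = refl
  ↥-^ᵘ x (suc k) = trans (↥-* x (x ^ᵘ k)) (cong (↥ x ℤ.*_) (↥-^ᵘ x k))

  ↧-^ᵘ : ∀ x k → ↧ (x ^ᵘ k) ≡ ↧ x ℤ.^ k
  ↧-^ᵘ x zero    = refl
  ↧-^ᵘ x (suc k) = trans (↧-* x (x ^ᵘ k)) (cong (↧ x ℤ.*_) (↧-^ᵘ x k))

  module _ (n : ℤ) (d : ℕ) where

    ↥-risingProdᵘ : ∀ k → ↥ risingProdᵘ (mkℚᵘ n d) k ≡ ∏ k (progression n (suc d))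
    ↥-risingProdᵘ zero    = refl
    ↥-risingProdᵘ (suc k) = trans (↥-* (risingProdᵘ (mkℚᵘ n d) k) _)
      (cong₂ ℤ._*_ (↥-risingProdᵘ k) (cong (ℤ._+ _) (ℤ.*-identityʳ n)))

    ↧-risingProdᵘ : ∀ k → ↧ risingProdᵘ (mkℚᵘ n d) k ≡ (+ suc d) ℤ.^ k
    ↧-risingProdᵘ zero    = refl
    ↧-risingProdᵘ (suc k) = begin
      ↧ (risingProdᵘ (mkℚᵘ n d) k ℚᵘ.* (mkℚᵘ n d ℚᵘ.+ mkℚᵘ (+ k) 0))
        ≡⟨ ↧-* (risingProdᵘ (mkℚᵘ n d) k) _ ⟩
      ↧ risingProdᵘ (mkℚᵘ n d) k ℤ.* + suc (d ℕ.* 1)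
        ≡⟨ cong₂ (λ a b → a ℤ.* + suc b) (↧-risingProdᵘ k) (ℕ.*-identityʳ d) ⟩
      (+ suc d) ℤ.^ k ℤ.* + suc d
        ≡⟨ ℤ.*-comm ((+ suc d) ℤ.^ k) (+ suc d) ⟩
      (+ suc d) ℤ.^ suc k
        ∎
      where open ≡-Reasoning

  risingProd≡^⇒ : ∀ n d .(c : Coprime ∣ n ∣ (suc d)) r e .(c′ : Coprime ∣ r ∣ (suc e)) k ℓ →
    risingProd (mkℚ n d c) k ≡ mkℚ r e c′ ^ℚ ℓ →
    ∏ k (progression n (suc d)) ℤ.* (+ suc e) ℤ.^ ℓ ≡ r ℤ.^ ℓ ℤ.* (+ suc d) ℤ.^ k
  risingProd≡^⇒ n d c r e c′ k ℓ eq
    with ≃-trans (≃-sym (toℚᵘ-risingProd (mkℚ n d c) k))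
           (≃-trans (≃-reflexive (cong ℚ.toℚᵘ eq)) (toℚᵘ-^ℚ (mkℚ r e c′) ℓ))
  ... | *≡* eqᵘ = subst₂ _≡_ (cong₂ ℤ._*_ (↥-risingProdᵘ n d k) (↧-^ᵘ (mkℚᵘ r e) ℓ))
                             (cong₂ ℤ._*_ (↥-^ᵘ (mkℚᵘ r e) ℓ) (↧-risingProdᵘ n d k)) eqᵘ

  splitClearedEquation : ∀ k ℓ n s r t → Coprime ∣ n ∣ s → Coprime ∣ r ∣ t → t ℕ.^ ℓ ≢ 0 →
    ∏ k (progression n s) ℤ.* (+ t) ℤ.^ ℓ ≡ r ℤ.^ ℓ ℤ.* (+ s) ℤ.^ k →
    s ℕ.^ k ≡ t ℕ.^ ℓ × ∣ ∏ k (progression n s) ∣ ≡ ∣ r ∣ ℕ.^ ℓ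
  splitClearedEquation k ℓ n s r t n⊥s r⊥t t^ℓ≢0 eq = s^k≡t^ℓ , ∣P∣≡∣r∣^ℓ
    where
    P : ℕ
    P = ∣ ∏ k (progression n s) ∣
    eqℕ : P ℕ.* t ℕ.^ ℓ ≡ ∣ r ∣ ℕ.^ ℓ ℕ.* s ℕ.^ k
    eqℕ = begin
      P ℕ.* t ℕ.^ ℓ                              ≡⟨ cong (P ℕ.*_) (abs-^ (+ t) ℓ) ⟨
      P ℕ.* ∣ (+ t) ℤ.^ ℓ ∣                      ≡⟨ ℤ.abs-* (∏ k (progression n s)) ((+ t) ℤ.^ ℓ) ⟨
      ∣ ∏ k (progression n s) ℤ.* (+ t) ℤ.^ ℓ ∣  ≡⟨ cong ∣_∣ eq ⟩
      ∣ r ℤ.^ ℓ ℤ.* (+ s) ℤ.^ k ∣                ≡⟨ ℤ.abs-* (r ℤ.^ ℓ) ((+ s) ℤ.^ k) ⟩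
      ∣ r ℤ.^ ℓ ∣ ℕ.* ∣ (+ s) ℤ.^ k ∣            ≡⟨ cong₂ ℕ._*_ (abs-^ r ℓ) (abs-^ (+ s) k) ⟩
      ∣ r ∣ ℕ.^ ℓ ℕ.* s ℕ.^ k                    ∎
      where open ≡-Reasoning
    s^k∣t^ℓ : s ℕ.^ k ∣ t ℕ.^ ℓ
    s^k∣t^ℓ = coprime-divisor
      (coprime-^ˡ k (Coprime.sym (coprime-∏ k (progression n s) λ {i} _ → coprime-progression n s n⊥s i)))
      (divides (∣ r ∣ ℕ.^ ℓ) eqℕ)
    t^ℓ∣s^k : t ℕ.^ ℓ ∣ s ℕ.^ k
    t^ℓ∣s^k = coprime-divisor (coprime-^ˡ ℓ (Coprime.sym (coprime-^ˡ ℓ r⊥t))) (divides P (sym eqℕ))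
    s^k≡t^ℓ : s ℕ.^ k ≡ t ℕ.^ ℓ
    s^k≡t^ℓ = ∣-antisym s^k∣t^ℓ t^ℓ∣s^k
    ∣P∣≡∣r∣^ℓ : P ≡ ∣ r ∣ ℕ.^ ℓ
    ∣P∣≡∣r∣^ℓ = ℕ.*-cancelʳ-≡ P (∣ r ∣ ℕ.^ ℓ) (t ℕ.^ ℓ) {{ℕ.≢-nonZero t^ℓ≢0}}
                  (trans eqℕ (cong (∣ r ∣ ℕ.^ ℓ ℕ.*_) s^k≡t^ℓ))

module TernaryEquations where

  open import Data.Nat.Base as ℕ using (ℕ; _≤_; _<_)
  import Data.Nat.Properties as ℕ
  open import Data.Nat.Divisibility using (_∣_; ∣⇒≤)
  open import Data.Nat.Primality using (Prime)
  open import Data.Integer.Base as ℤ using (ℤ; +_; ∣_∣)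
  import Data.Integer.Properties as ℤ
  open import Data.Product.Base using (_×_; _,_; ∃-syntax)
  open import Data.Sum.Base using (_⊎_; inj₁; inj₂; [_,_]′)
  open import Function.Base using (_∘_)
  open import Relation.Nullary using (¬_)
  open import Relation.Binary.PropositionalEquality
  open NatFacts using (prime>1; n<2^n)
  open IntFacts using (prime∣∣*∣)

  record Admissible (k ℓ p : ℕ) (a : ℤ) : Set where
    field
      a≢0       : a ≢ ℤ.0ℤ
      powerFree : PowerFree ℓ a
      primes≤k  : PrimeDivisorsAtMost k a
      p∤a       : ¬ p ∣ ∣ a ∣

  ExactlyOneDivisible : ℕ → ℤ → ℤ → ℤ → Set
  ExactlyOneDivisible p u v w = (p ∣ ∣ u ∣ × ¬ (p ∣ ∣ v ∣) × ¬ (p ∣ ∣ w ∣))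
                              ⊎ (¬ (p ∣ ∣ u ∣) × p ∣ ∣ v ∣ × ¬ (p ∣ ∣ w ∣))
                              ⊎ (¬ (p ∣ ∣ u ∣) × ¬ (p ∣ ∣ v ∣) × p ∣ ∣ w ∣)

  TernaryEquation : ℕ → ℕ → ℕ → Set
  TernaryEquation k ℓ p = ∃[ a ] ∃[ b ] ∃[ c ] ∃[ u ] ∃[ v ] ∃[ w ]
    ( a ≢ ℤ.0ℤ × b ≢ ℤ.0ℤ × c ≢ ℤ.0ℤ × u ≢ ℤ.0ℤ × v ≢ ℤ.0ℤ × w ≢ ℤ.0ℤ
    × a ℤ.* u ℤ.^ ℓ ℤ.+ b ℤ.* v ℤ.^ ℓ ℤ.+ c ℤ.* w ℤ.^ ℓ ≡ ℤ.0ℤ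
    × PowerFree ℓ a × PowerFree ℓ b × PowerFree ℓ c
    × PrimeDivisorsAtMost k (a ℤ.* b ℤ.* c)
    × ¬ (p ∣ ∣ a ℤ.* b ℤ.* c ∣)
    × ExactlyOneDivisible p u v w )

  module _ {k ℓ p : ℕ} where

    admissible-neg : ∀ {a} → Admissible k ℓ p a → Admissible k ℓ p (ℤ.- a)
    admissible-neg {a} adm = record
      { a≢0       = λ -a≡0 → a≢0 (trans (sym (ℤ.neg-involutive a)) (cong ℤ.-_ -a≡0))
      ; powerFree = λ q pq → powerFree q pq ∘ subst (q ℕ.^ ℓ ∣_) (ℤ.∣-i∣≡∣i∣ a)
      ; primes≤k  = λ q pq → primes≤k q pq ∘ subst (q ∣_) (ℤ.∣-i∣≡∣i∣ a)
      ; p∤a       = p∤a ∘ subst (p ∣_) (ℤ.∣-i∣≡∣i∣ a)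
      }
      where open Admissible adm

    admissible-small : ∀ {m} → 0 < m → m < p → p ≤ k → k < ℓ → Admissible k ℓ p (+ m)
    admissible-small {m} 0<m m<p p≤k k<ℓ = record
      { a≢0       = λ m≡0 → ℕ.<⇒≢ 0<m (sym (cong ∣_∣ m≡0))
      ; powerFree = λ q pq q^ℓ∣m → ℕ.<-irrefl refl (begin-strict
          ℓ        <⟨ n<2^n ℓ ⟩
          2 ℕ.^ ℓ  ≤⟨ ℕ.^-monoˡ-≤ ℓ (prime>1 pq) ⟩
          q ℕ.^ ℓ  ≤⟨ ∣⇒≤ q^ℓ∣m ⟩
          m        <⟨ ℕ.<-≤-trans m<p p≤k ⟩
          k        <⟨ k<ℓ ⟩
          ℓ        ∎)
      ; primes≤k  = λ q pq q∣m → ℕ.≤-trans (∣⇒≤ q∣m) (ℕ.≤-trans (ℕ.<⇒≤ m<p) p≤k)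
      ; p∤a       = λ p∣m → ℕ.<⇒≱ m<p (∣⇒≤ p∣m)
      }
      where
      open ℕ.≤-Reasoning
      instance
        m≢0 : ℕ.NonZero m
        m≢0 = ℕ.>-nonZero 0<m

    mkTernaryEquation : Prime p → ∀ {a b c u v w} →
      Admissible k ℓ p a → Admissible k ℓ p b → Admissible k ℓ p c →
      u ≢ ℤ.0ℤ → v ≢ ℤ.0ℤ → w ≢ ℤ.0ℤ →
      a ℤ.* u ℤ.^ ℓ ℤ.+ b ℤ.* v ℤ.^ ℓ ℤ.+ c ℤ.* w ℤ.^ ℓ ≡ ℤ.0ℤ →
      ExactlyOneDivisible p u v w → TernaryEquation k ℓ p
    mkTernaryEquation pp {a} {b} {c} {u} {v} {w} adm-a adm-b adm-c u≢0 v≢0 w≢0 equation exactlyOne =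
      a , b , c , u , v , w , A.a≢0 adm-a , A.a≢0 adm-b , A.a≢0 adm-c , u≢0 , v≢0 , w≢0 , equation ,
      A.powerFree adm-a , A.powerFree adm-b , A.powerFree adm-c , primes≤k , p∤abc , exactlyOne
      where
      module A = Admissible
      prime∣abc⇒ : ∀ {q} → Prime q → q ∣ ∣ a ℤ.* b ℤ.* c ∣ → ((q ∣ ∣ a ∣) ⊎ (q ∣ ∣ b ∣)) ⊎ (q ∣ ∣ c ∣)
      prime∣abc⇒ pq q∣abc with prime∣∣*∣ pq (a ℤ.* b) c q∣abc
      ... | inj₁ q∣ab = inj₁ (prime∣∣*∣ pq a b q∣ab)
      ... | inj₂ q∣c  = inj₂ q∣c
      primes≤k : PrimeDivisorsAtMost k (a ℤ.* b ℤ.* c)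
      primes≤k q pq = [ [ A.primes≤k adm-a q pq , A.primes≤k adm-b q pq ]′ , A.primes≤k adm-c q pq ]′ ∘ prime∣abc⇒ pq
      p∤abc : ¬ p ∣ ∣ a ℤ.* b ℤ.* c ∣
      p∤abc = [ [ A.p∤a adm-a , A.p∤a adm-b ]′ , A.p∤a adm-c ]′ ∘ prime∣abc⇒ pp

module PowerProgression (k ℓ : ℕ) .{{_ : ℕ.NonZero ℓ}} (2≤k : 2 ≤ k) (k<ℓ : k < ℓ)
  (n : ℤ) (s : ℕ) .{{_ : ℕ.NonZero s}} (n⊥s : Coprime ∣ n ∣ s) (D : ℕ) (s≡D^ℓ : s ≡ D ℕ.^ ℓ)
  (R : ℕ) (R≢0 : R ≢ 0) (∣∏∣≡R^ℓ : ∣ Products.∏ k (Products.progression n s) ∣ ≡ R ℕ.^ ℓ)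
  (p : ℕ) (pp : Prime p) (k<2p : k < 2 ℕ.* p) (p≤k : p ≤ k) where

  open import Data.Nat.Base as ℕ using (ℕ; suc; _≤_; _<_; _∸_)
  import Data.Nat.Properties as ℕ
  open import Data.Nat.Divisibility using (_∣_; _∣?_; ∣⇒≤; ∣-trans; m∣m*n)
  open import Data.Nat.Primality using (Prime; prime⇒nonZero)
  open import Data.Nat.Coprimality using (Coprime)
  open import Data.Integer.Base as ℤ using (ℤ; +_; ∣_∣)
  import Data.Integer.Properties as ℤ
  open import Data.Integer.Tactic.RingSolver using (solve-∀)
  open import Data.Product.Base using (∃; _×_; _,_)
  open import Data.Sum.Base using (_⊎_; inj₁; inj₂; [_,_]′)
  open import Function.Base using (_∘_; id)
  open import Relation.Nullary using (¬_; yes; no)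
  open import Relation.Nullary.Negation using (contradiction)
  open import Relation.Binary.Definitions using (tri<; tri≈; tri>)
  open import Relation.Binary.PropositionalEquality
  open NatFacts using (prime>1; m∣m^n; prime∣^⇒∣; 0^n≡0; ∣∧0<∧<2*⇒≡)
  open IntFacts using (pos-^; ^-distribʳ-*; *-≢0; prime∣∣*∣; PowerFreeForm; powerFreeForm; *-powerFreeForm)
  open Products
  open TernaryEquations

  A : ℕ → ℤ
  A = progression n s

  private variable i j q : ℕ

  term≢0 : i < k → A i ≢ ℤ.0ℤ
  term≢0 {i} i<k Ai≡0 = R≢0 (ℕ.m^n≡0⇒m≡0 R ℓ (begin
    R ℕ.^ ℓ                       ≡⟨ ∣∏∣≡R^ℓ ⟨
    ∣ ∏ k A ∣                     ≡⟨ cong ∣_∣ (∏-without A i<k) ⟩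
    ∣ A i ℤ.* ∏ k (without A i) ∣ ≡⟨ cong (λ x → ∣ x ℤ.* ∏ k (without A i) ∣) Ai≡0 ⟩
    0                             ∎))
    where open ≡-Reasoning

  termForm : i < k → PowerFreeForm ℓ (A i) ∣ ∏ k (without A i) ∣
  termForm {i} i<k = powerFreeForm ℓ (A i) _ R (term≢0 i<k)
    (trans (sym (ℤ.abs-* (A i) (∏ k (without A i)))) (trans (cong ∣_∣ (sym (∏-without A i<k))) ∣∏∣≡R^ℓ))

  prime∣A²⇒∣∸ : Prime q → i ≤ j → q ∣ ∣ A i ∣ → q ∣ ∣ A j ∣ → q ∣ j ∸ i
  prime∣A²⇒∣∸ {q} {i} {j} pq i≤j q∣Ai q∣Aj = prime∣A[i]∣A[i+δ]⇒∣δ n s n⊥s pq i (j ∸ i) q∣Ai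
    (subst (λ m → q ∣ ∣ A m ∣) (sym (ℕ.m+[n∸m]≡n i≤j)) q∣Aj)

  prime∣A²⇒≤∸ : Prime q → i < j → q ∣ ∣ A i ∣ → q ∣ ∣ A j ∣ → q ≤ j ∸ i
  prime∣A²⇒≤∸ pq i<j q∣Ai q∣Aj =
    ∣⇒≤ {{ℕ.>-nonZero (ℕ.m<n⇒0<n∸m i<j)}} (prime∣A²⇒∣∸ pq (ℕ.<⇒≤ i<j) q∣Ai q∣Aj)

  commonPrime<k : Prime q → i < k → j < k → i ≢ j → q ∣ ∣ A i ∣ → q ∣ ∣ A j ∣ → q < k
  commonPrime<k {q} {i} {j} pq i<k j<k i≢j q∣Ai q∣Aj with ℕ.<-cmp i j
  ... | tri< i<j _ _ = ℕ.≤-<-trans (prime∣A²⇒≤∸ pq i<j q∣Ai q∣Aj) (ℕ.≤-<-trans (ℕ.m∸n≤m j i) j<k)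
  ... | tri≈ _ i≡j _ = contradiction i≡j i≢j
  ... | tri> _ _ j<i = ℕ.≤-<-trans (prime∣A²⇒≤∸ pq j<i q∣Aj q∣Ai) (ℕ.≤-<-trans (ℕ.m∸n≤m i j) i<k)

  p∣A²⇒≡+p : i < j → j < k → p ∣ ∣ A i ∣ → p ∣ ∣ A j ∣ → j ≡ i ℕ.+ p
  p∣A²⇒≡+p {i} {j} i<j j<k p∣Ai p∣Aj = begin
    j              ≡⟨ ℕ.m+[n∸m]≡n (ℕ.<⇒≤ i<j) ⟨
    i ℕ.+ (j ∸ i)  ≡⟨ cong (i ℕ.+_) (∣∧0<∧<2*⇒≡ (prime∣A²⇒∣∸ pp (ℕ.<⇒≤ i<j) p∣Ai p∣Aj) (ℕ.m<n⇒0<n∸m i<j) j-i<2p) ⟩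
    i ℕ.+ p        ∎
    where
    open ≡-Reasoning
    j-i<2p : j ∸ i < 2 ℕ.* p
    j-i<2p = ℕ.≤-<-trans (ℕ.m∸n≤m j i) (ℕ.<-trans j<k k<2p)

  prime∣termCoeff⇒ : Prime q → (i<k : i < k) → q ∣ ∣ PowerFreeForm.coeff (termForm i<k) ∣ →
                     q ∣ ∣ A i ∣ × ∃ λ j → j < k × j ≢ i × q ∣ ∣ A j ∣
  prime∣termCoeff⇒ {q} {i} pq i<k q∣a =
    F.∣coeff⇒∣M q∣a , prime∣∏without⇒ pq k A i (F.coeff∣⇒∣N q pq q∣a)
    where module F = PowerFreeForm (termForm i<k)

  termCoeff-primes≤k : (i<k : i < k) → PrimeDivisorsAtMost k (PowerFreeForm.coeff (termForm i<k))
  termCoeff-primes≤k i<k q pq q∣a with prime∣termCoeff⇒ pq i<k q∣a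
  ... | q∣Ai , j , j<k , j≢i , q∣Aj = ℕ.<⇒≤ (commonPrime<k pq i<k j<k (j≢i ∘ sym) q∣Ai q∣Aj)

  p∤A⇒p∤termBase : (i<k : i < k) → ¬ p ∣ ∣ A i ∣ → ¬ p ∣ ∣ PowerFreeForm.base (termForm i<k) ∣
  p∤A⇒p∤termBase i<k p∤Ai = p∤Ai ∘ PowerFreeForm.∣base⇒∣M (termForm i<k)

  p∣A⇒p∤s : ∀ i → p ∣ ∣ A i ∣ → ¬ p ∣ s
  p∣A⇒p∤s i p∣Ai p∣s = ℕ.<⇒≢ (prime>1 pp) (sym (coprime-progression n s n⊥s i (p∣Ai , p∣s)))

  p∣s⇒p∣D : p ∣ s → p ∣ D
  p∣s⇒p∣D p∣s = prime∣^⇒∣ {n = ℓ} pp (subst (p ∣_) s≡D^ℓ p∣s)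

  p∤s⇒p∤D : ¬ p ∣ s → ¬ p ∣ D
  p∤s⇒p∤D p∤s p∣D = p∤s (subst (p ∣_) (sym s≡D^ℓ) (∣-trans p∣D (m∣m^n D ℓ)))

  +D^ℓ≡+s : (+ D) ℤ.^ ℓ ≡ + s
  +D^ℓ≡+s = trans (sym (pos-^ D ℓ)) (cong +_ (sym s≡D^ℓ))

  +D≢0 : + D ≢ ℤ.0ℤ
  +D≢0 D≡0 = ℕ.≢-nonZero⁻¹ s (trans s≡D^ℓ (trans (cong (ℕ._^ ℓ) (cong ∣_∣ D≡0)) (0^n≡0 ℓ)))

  A[i]-A[1+i]+s≡0 : ∀ i → A i ℤ.- A (suc i) ℤ.+ + s ≡ ℤ.0ℤ
  A[i]-A[1+i]+s≡0 i = trans (cong (λ x → A i ℤ.- (n ℤ.+ x ℤ.* + s) ℤ.+ + s) (ℤ.pos-+ 1 i)) (lemma n (+ i) (+ s))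
    where
    lemma : ∀ n i s → n ℤ.+ i ℤ.* s ℤ.- (n ℤ.+ (ℤ.1ℤ ℤ.+ i) ℤ.* s) ℤ.+ s ≡ ℤ.0ℤ
    lemma = solve-∀

  A-crossIdentity : ∀ i m → A i ℤ.* A (i ℕ.+ suc m) ℤ.- A (suc i) ℤ.* A (i ℕ.+ m) ℤ.+ + m ℤ.* (+ s ℤ.* + s) ≡ ℤ.0ℤ
  A-crossIdentity i m = begin
    A i ℤ.* A (i ℕ.+ suc m) ℤ.- A (suc i) ℤ.* A (i ℕ.+ m) ℤ.+ + m ℤ.* (+ s ℤ.* + s)
      ≡⟨ cong₂ (λ x y → A i ℤ.* x ℤ.- y ℤ.+ + m ℤ.* (+ s ℤ.* + s))
           (trans (A-+ i (suc m)) (cong (λ z → n ℤ.+ (+ i ℤ.+ z) ℤ.* + s) (ℤ.pos-+ 1 m)))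
           (cong₂ ℤ._*_ (A-+ 1 i) (A-+ i m)) ⟩
    A i ℤ.* (n ℤ.+ (+ i ℤ.+ (ℤ.1ℤ ℤ.+ + m)) ℤ.* + s)
      ℤ.- (n ℤ.+ (ℤ.1ℤ ℤ.+ + i) ℤ.* + s) ℤ.* (n ℤ.+ (+ i ℤ.+ + m) ℤ.* + s) ℤ.+ + m ℤ.* (+ s ℤ.* + s)
      ≡⟨ lemma n (+ i) (+ m) (+ s) ⟩
    ℤ.0ℤ ∎
    where
    open ≡-Reasoning
    A-+ : ∀ a b → A (a ℕ.+ b) ≡ n ℤ.+ (+ a ℤ.+ + b) ℤ.* + s
    A-+ a b = cong (λ x → n ℤ.+ x ℤ.* + s) (ℤ.pos-+ a b)
    lemma : ∀ n i m s → (n ℤ.+ i ℤ.* s) ℤ.* (n ℤ.+ (i ℤ.+ (ℤ.1ℤ ℤ.+ m)) ℤ.* s)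
                        ℤ.- (n ℤ.+ (ℤ.1ℤ ℤ.+ i) ℤ.* s) ℤ.* (n ℤ.+ (i ℤ.+ m) ℤ.* s) ℤ.+ m ℤ.* (s ℤ.* s) ≡ ℤ.0ℤ
    lemma = solve-∀

  AtMostOneMultiple : Set
  AtMostOneMultiple = ∀ {i j} → i < k → j < k → p ∣ ∣ A i ∣ → p ∣ ∣ A j ∣ → i ≡ j

  module _ (unique : AtMostOneMultiple) where

    p∤termCoeff : (i<k : i < k) → ¬ p ∣ ∣ PowerFreeForm.coeff (termForm i<k) ∣
    p∤termCoeff i<k p∣a with prime∣termCoeff⇒ pp i<k p∣a
    ... | p∣Ai , j , j<k , j≢i , p∣Aj = j≢i (unique j<k i<k p∣Aj p∣Ai)

    termCoeff-admissible : (i<k : i < k) → Admissible k ℓ p (PowerFreeForm.coeff (termForm i<k))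
    termCoeff-admissible i<k = record
      { a≢0 = F.coeff≢0 ; powerFree = F.powerFree ; primes≤k = termCoeff-primes≤k i<k ; p∤a = p∤termCoeff i<k }
      where module F = PowerFreeForm (termForm i<k)

    p∣A⇒p∣termBase : (i<k : i < k) → p ∣ ∣ A i ∣ → p ∣ ∣ PowerFreeForm.base (termForm i<k) ∣
    p∣A⇒p∣termBase i<k p∣Ai = PowerFreeForm.prime∣M∤coeff⇒∣base (termForm i<k) pp p∣Ai (p∤termCoeff i<k)

    consecutive-exactlyOne : (i+1<k : suc i < k) → (p ∣ ∣ A i ∣) ⊎ (p ∣ ∣ A (suc i) ∣) ⊎ (p ∣ s) →
      ExactlyOneDivisible p (PowerFreeForm.base (termForm (ℕ.<⇒≤ i+1<k)))
                            (PowerFreeForm.base (termForm i+1<k)) (+ D)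
    consecutive-exactlyOne {i} i+1<k (inj₁ p∣Ai) = inj₁
      ( p∣A⇒p∣termBase (ℕ.<⇒≤ i+1<k) p∣Ai
      , p∤A⇒p∤termBase i+1<k (λ p∣Ai+1 → ℕ.1+n≢n (unique i+1<k (ℕ.<⇒≤ i+1<k) p∣Ai+1 p∣Ai))
      , p∤s⇒p∤D (p∣A⇒p∤s i p∣Ai) )
    consecutive-exactlyOne {i} i+1<k (inj₂ (inj₁ p∣Ai+1)) = inj₂ (inj₁
      ( p∤A⇒p∤termBase (ℕ.<⇒≤ i+1<k) (λ p∣Ai → ℕ.1+n≢n (unique i+1<k (ℕ.<⇒≤ i+1<k) p∣Ai+1 p∣Ai))
      , p∣A⇒p∣termBase i+1<k p∣Ai+1
      , p∤s⇒p∤D (p∣A⇒p∤s (suc i) p∣Ai+1) ))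
    consecutive-exactlyOne {i} i+1<k (inj₂ (inj₂ p∣s)) = inj₂ (inj₂
      ( p∤A⇒p∤termBase (ℕ.<⇒≤ i+1<k) (λ p∣Ai → p∣A⇒p∤s i p∣Ai p∣s)
      , p∤A⇒p∤termBase i+1<k (λ p∣Ai+1 → p∣A⇒p∤s (suc i) p∣Ai+1 p∣s)
      , p∣s⇒p∣D p∣s ))

    consecutiveEquation : suc i < k → (p ∣ ∣ A i ∣) ⊎ (p ∣ ∣ A (suc i) ∣) ⊎ (p ∣ s) → TernaryEquation k ℓ p
    consecutiveEquation {i} i+1<k p∣term-or-s =
      mkTernaryEquation pp (termCoeff-admissible i<k) (admissible-neg (termCoeff-admissible i+1<k))
        (admissible-small ℕ.z<s (prime>1 pp) p≤k k<ℓ) F₀.base≢0 F₁.base≢0 +D≢0 equation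
        (consecutive-exactlyOne i+1<k p∣term-or-s)
      where
      i<k : i < k
      i<k = ℕ.<⇒≤ i+1<k
      module F₀ = PowerFreeForm (termForm i<k)
      module F₁ = PowerFreeForm (termForm i+1<k)
      lemma : ∀ a X b Y Z → a ℤ.* X ℤ.+ ℤ.- b ℤ.* Y ℤ.+ ℤ.1ℤ ℤ.* Z ≡ a ℤ.* X ℤ.- b ℤ.* Y ℤ.+ Z
      lemma = solve-∀
      equation : F₀.coeff ℤ.* F₀.base ℤ.^ ℓ ℤ.+ ℤ.- F₁.coeff ℤ.* F₁.base ℤ.^ ℓ ℤ.+ ℤ.1ℤ ℤ.* (+ D) ℤ.^ ℓ ≡ ℤ.0ℤ
      equation = begin
        F₀.coeff ℤ.* F₀.base ℤ.^ ℓ ℤ.+ ℤ.- F₁.coeff ℤ.* F₁.base ℤ.^ ℓ ℤ.+ ℤ.1ℤ ℤ.* (+ D) ℤ.^ ℓ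
          ≡⟨ lemma F₀.coeff (F₀.base ℤ.^ ℓ) F₁.coeff (F₁.base ℤ.^ ℓ) ((+ D) ℤ.^ ℓ) ⟩
        F₀.coeff ℤ.* F₀.base ℤ.^ ℓ ℤ.- F₁.coeff ℤ.* F₁.base ℤ.^ ℓ ℤ.+ (+ D) ℤ.^ ℓ
          ≡⟨ cong₂ ℤ._+_ (cong₂ ℤ._-_ F₀.M≡coeff*base^ℓ F₁.M≡coeff*base^ℓ) (sym +D^ℓ≡+s) ⟨
        A i ℤ.- A (suc i) ℤ.+ + s
          ≡⟨ A[i]-A[1+i]+s≡0 i ⟩
        ℤ.0ℤ ∎
        where open ≡-Reasoning

  module _ (p∤s : ¬ p ∣ s) {i₀} (i₀<p : i₀ < p) (p∣Ai₀ : p ∣ ∣ A i₀ ∣) where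

    i₀<k : i₀ < k
    i₀<k = ℕ.<-≤-trans i₀<p p≤k

    partner : j < k → p ∣ ∣ A j ∣ → j ≡ i₀ ⊎ j ≡ i₀ ℕ.+ p
    partner {j} j<k p∣Aj with ℕ.<-cmp i₀ j
    ... | tri< i₀<j _ _ = inj₂ (p∣A²⇒≡+p i₀<j j<k p∣Ai₀ p∣Aj)
    ... | tri≈ _ i₀≡j _ = inj₁ (sym i₀≡j)
    ... | tri> _ _ j<i₀ = contradiction (p∣A²⇒≡+p j<i₀ i₀<k p∣Aj p∣Ai₀) (ℕ.<⇒≢ (ℕ.<-≤-trans i₀<p (ℕ.m≤n+m p j)))

    module _ (k≤i₀+p : k ≤ i₀ ℕ.+ p) where

      onlyMultiple : j < k → p ∣ ∣ A j ∣ → j ≡ i₀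
      onlyMultiple j<k p∣Aj = [ id , (λ j≡i₀+p → contradiction (subst (_< k) j≡i₀+p j<k) (ℕ.≤⇒≯ k≤i₀+p)) ]′ (partner j<k p∣Aj)

      unique : AtMostOneMultiple
      unique i<k j<k p∣Ai p∣Aj = trans (onlyMultiple i<k p∣Ai) (sym (onlyMultiple j<k p∣Aj))

      isolatedEquation : TernaryEquation k ℓ p
      isolatedEquation with suc i₀ ℕ.<? k
      ... | yes i₀+1<k = consecutiveEquation unique i₀+1<k (inj₁ p∣Ai₀)
      ... | no  i₀+1≮k = consecutiveEquation unique (subst (_< k) (sym i₀≡) i₀<k)
                           (inj₂ (inj₁ (subst (λ m → p ∣ ∣ A m ∣) (sym i₀≡) p∣Ai₀)))
        where
        i₀≢0 : i₀ ≢ 0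
        i₀≢0 refl = i₀+1≮k 2≤k
        i₀≡ : suc (ℕ.pred i₀) ≡ i₀
        i₀≡ = ℕ.suc-pred i₀ {{ℕ.≢-nonZero i₀≢0}}


    module _ (i₀+p<k : i₀ ℕ.+ p < k) where

      p-1 : ℕ
      p-1 = ℕ.pred p

      1+[p-1]≡p : suc p-1 ≡ p
      1+[p-1]≡p = ℕ.suc-pred p {{prime⇒nonZero pp}}

      i₁ j₁ j₂ : ℕ
      i₁ = i₀ ℕ.+ p
      j₁ = suc i₀
      j₂ = i₀ ℕ.+ p-1

      0<p-1 : 0 < p-1
      0<p-1 = ℕ.pred-mono-≤ (prime>1 pp)

      p-1<p : p-1 < p
      p-1<p = subst (p-1 <_) 1+[p-1]≡p (ℕ.n<1+n p-1)

      p∤A-between : i₀ < j → j < i₁ → ¬ p ∣ ∣ A j ∣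
      p∤A-between i₀<j j<i₁ p∣Aj =
        [ ℕ.>⇒≢ i₀<j , ℕ.<⇒≢ j<i₁ ]′ (partner (ℕ.<-trans j<i₁ i₀+p<k) p∣Aj)

      i₀<j₁ : i₀ < j₁
      i₀<j₁ = ℕ.n<1+n i₀

      j₁<i₁ : j₁ < i₁
      j₁<i₁ = subst (_< i₁) (ℕ.+-comm i₀ 1) (ℕ.+-monoʳ-< i₀ (prime>1 pp))

      i₀<j₂ : i₀ < j₂
      i₀<j₂ = ℕ.m<m+n i₀ 0<p-1

      j₂<i₁ : j₂ < i₁
      j₂<i₁ = ℕ.+-monoʳ-< i₀ p-1<p

      pairForm : PowerFreeForm ℓ (A i₀ ℤ.* A i₁) ∣ ∏ k (without (without A i₀) i₁) ∣
      pairForm = powerFreeForm ℓ _ _ R (*-≢0 (term≢0 i₀<k) (term≢0 i₀+p<k))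
        (trans (sym (ℤ.abs-* (A i₀ ℤ.* A i₁) _)) (trans (cong ∣_∣ (sym (∏-without² A i₀<k i₀+p<k i₁≢i₀))) ∣∏∣≡R^ℓ))
        where
        i₁≢i₀ : i₁ ≢ i₀
        i₁≢i₀ = ℕ.>⇒≢ (ℕ.m<m+n i₀ (ℕ.<-trans ℕ.z<s (prime>1 pp)))

      module α = PowerFreeForm pairForm

      prime∣α⇒ : Prime q → q ∣ ∣ α.coeff ∣ →
                 ((q ∣ ∣ A i₀ ∣) ⊎ (q ∣ ∣ A i₁ ∣)) × ∃ λ j → j < k × j ≢ i₀ × j ≢ i₁ × q ∣ ∣ A j ∣
      prime∣α⇒ pq q∣α with prime∣∏without⇒ pq k (without A i₀) i₁ (α.coeff∣⇒∣N _ pq q∣α)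
      ... | j , j<k , j≢i₁ , q∣A′j with prime∣without⇒ pq A i₀ j q∣A′j
      ... | j≢i₀ , q∣Aj = prime∣∣*∣ pq (A i₀) (A i₁) (α.∣coeff⇒∣M q∣α) , j , j<k , j≢i₀ , j≢i₁ , q∣Aj

      α-admissible : Admissible k ℓ p α.coeff
      α-admissible = record { a≢0 = α.coeff≢0 ; powerFree = α.powerFree ; primes≤k = primes≤k ; p∤a = p∤α }
        where
        primes≤k : PrimeDivisorsAtMost k α.coeff
        primes≤k q pq q∣α with prime∣α⇒ pq q∣α
        ... | inj₁ q∣Ai₀ , j , j<k , j≢i₀ , _ , q∣Aj = ℕ.<⇒≤ (commonPrime<k pq i₀<k j<k (j≢i₀ ∘ sym) q∣Ai₀ q∣Aj)
        ... | inj₂ q∣Ai₁ , j , j<k , _ , j≢i₁ , q∣Aj = ℕ.<⇒≤ (commonPrime<k pq i₀+p<k j<k (j≢i₁ ∘ sym) q∣Ai₁ q∣Aj)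
        p∤α : ¬ p ∣ ∣ α.coeff ∣
        p∤α p∣α with prime∣α⇒ pp p∣α
        ... | _ , j , j<k , j≢i₀ , j≢i₁ , p∣Aj = [ j≢i₀ , j≢i₁ ]′ (partner j<k p∣Aj)

      p∣U : p ∣ ∣ α.base ∣
      p∣U = α.prime∣M∤coeff⇒∣base pp (subst (p ∣_) (sym (ℤ.abs-* (A i₀) (A i₁))) (∣-trans p∣Ai₀ (m∣m*n _)))
              (Admissible.p∤a α-admissible)

      j₁<k : j₁ < k
      j₁<k = ℕ.<-trans j₁<i₁ i₀+p<k

      j₂<k : j₂ < k
      j₂<k = ℕ.<-trans j₂<i₁ i₀+p<k

      b₁ b₂ : ℤ
      b₁ = PowerFreeForm.coeff (termForm j₁<k)
      b₂ = PowerFreeForm.coeff (termForm j₂<k)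

      -- Combining two single-term forms, rather than taking a pair form as for α, also
      -- covers j₁ = j₂, which happens for p = 2.
      module β = PowerFreeForm (*-powerFreeForm (termForm j₁<k) (termForm j₂<k))

      p∤Aj₁*Aj₂ : ¬ p ∣ ∣ A j₁ ℤ.* A j₂ ∣
      p∤Aj₁*Aj₂ = [ p∤A-between i₀<j₁ j₁<i₁ , p∤A-between i₀<j₂ j₂<i₁ ]′ ∘ prime∣∣*∣ pp (A j₁) (A j₂)

      β-admissible : Admissible k ℓ p β.coeff
      β-admissible = record
        { a≢0 = β.coeff≢0
        ; powerFree = β.powerFree
        ; primes≤k = λ q pq q∣β → [ termCoeff-primes≤k j₁<k q pq , termCoeff-primes≤k j₂<k q pq ]′
                                     (prime∣∣*∣ pq b₁ b₂ (β.coeff∣⇒∣N q pq q∣β))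
        ; p∤a = p∤Aj₁*Aj₂ ∘ β.∣coeff⇒∣M
        }

      W : ℤ
      W = + D ℤ.* + D

      p∤W : ¬ p ∣ ∣ W ∣
      p∤W = [ p∤s⇒p∤D p∤s , p∤s⇒p∤D p∤s ]′ ∘ prime∣∣*∣ pp (+ D) (+ D)

      equation : α.coeff ℤ.* α.base ℤ.^ ℓ ℤ.+ ℤ.- β.coeff ℤ.* β.base ℤ.^ ℓ ℤ.+ + p-1 ℤ.* W ℤ.^ ℓ ≡ ℤ.0ℤ
      equation = begin
        α.coeff ℤ.* α.base ℤ.^ ℓ ℤ.+ ℤ.- β.coeff ℤ.* β.base ℤ.^ ℓ ℤ.+ + p-1 ℤ.* W ℤ.^ ℓ
          ≡⟨ lemma α.coeff (α.base ℤ.^ ℓ) β.coeff (β.base ℤ.^ ℓ) (+ p-1) (W ℤ.^ ℓ) ⟩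
        α.coeff ℤ.* α.base ℤ.^ ℓ ℤ.- β.coeff ℤ.* β.base ℤ.^ ℓ ℤ.+ + p-1 ℤ.* W ℤ.^ ℓ
          ≡⟨ cong₂ ℤ._+_ (cong₂ ℤ._-_ α.M≡coeff*base^ℓ β.M≡coeff*base^ℓ) (sym [p-1]*W^ℓ≡[p-1]*s²) ⟨
        A i₀ ℤ.* A (i₀ ℕ.+ p) ℤ.- A j₁ ℤ.* A j₂ ℤ.+ + p-1 ℤ.* (+ s ℤ.* + s)
          ≡⟨ cong (λ m → A i₀ ℤ.* A (i₀ ℕ.+ m) ℤ.- A j₁ ℤ.* A j₂ ℤ.+ + p-1 ℤ.* (+ s ℤ.* + s)) 1+[p-1]≡p ⟨
        A i₀ ℤ.* A (i₀ ℕ.+ suc p-1) ℤ.- A (suc i₀) ℤ.* A (i₀ ℕ.+ p-1) ℤ.+ + p-1 ℤ.* (+ s ℤ.* + s)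
          ≡⟨ A-crossIdentity i₀ p-1 ⟩
        ℤ.0ℤ ∎
        where
        open ≡-Reasoning
        lemma : ∀ a X b Y c Z → a ℤ.* X ℤ.+ ℤ.- b ℤ.* Y ℤ.+ c ℤ.* Z ≡ a ℤ.* X ℤ.- b ℤ.* Y ℤ.+ c ℤ.* Z
        lemma = solve-∀
        [p-1]*W^ℓ≡[p-1]*s² : + p-1 ℤ.* W ℤ.^ ℓ ≡ + p-1 ℤ.* (+ s ℤ.* + s)
        [p-1]*W^ℓ≡[p-1]*s² = cong ((+ p-1) ℤ.*_) (trans (^-distribʳ-* (+ D) (+ D) ℓ) (cong₂ ℤ._*_ +D^ℓ≡+s +D^ℓ≡+s))

      quadraticEquation : TernaryEquation k ℓ p
      quadraticEquation =
        mkTernaryEquation pp α-admissible (admissible-neg β-admissible) (admissible-small 0<p-1 p-1<p p≤k k<ℓ)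
          α.base≢0 β.base≢0 (*-≢0 +D≢0 +D≢0) equation (inj₁ (p∣U , p∤Aj₁*Aj₂ ∘ β.∣base⇒∣M , p∤W))

  ternaryEquation : TernaryEquation k ℓ p
  ternaryEquation with p ∣? s
  ... | yes p∣s = consecutiveEquation (λ {i} _ _ p∣Ai _ → contradiction p∣s (p∣A⇒p∤s i p∣Ai)) 2≤k (inj₂ (inj₂ p∣s))
  ... | no  p∤s = fromMultiple (progression-hits-multiple n s pp p∤s)
    where
    fromMultiple : ∃ (λ i → i < p × p ∣ ∣ A i ∣) → TernaryEquation k ℓ p
    fromMultiple (i₀ , i₀<p , p∣Ai₀) with i₀ ℕ.+ p ℕ.<? k
    ... | yes i₀+p<k = quadraticEquation p∤s i₀<p p∣Ai₀ i₀+p<k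
    ... | no  i₀+p≮k = isolatedEquation p∤s i₀<p p∣Ai₀ (ℕ.≮⇒≥ i₀+p≮k)

open NatFacts using (^≡^⇒∃^)
open ClearDenominators using (risingProd≡^⇒; splitClearedEquation)

lemma2p1 : (k ℓ : ℕ) → 2 ≤ k → Prime ℓ → k < ℓ →
           (x y : ℚ) → y ≢ 0ℚ → risingProd x k ≡ y ^ℚ ℓ →
           (p : ℕ) → Prime p → k < 2 ℕ.* p → p ≤ k →
           ∃[ a ] ∃[ b ] ∃[ c ] ∃[ u ] ∃[ v ] ∃[ w ]
             ( a ≢ ℤ.0ℤ × b ≢ ℤ.0ℤ × c ≢ ℤ.0ℤ × u ≢ ℤ.0ℤ × v ≢ ℤ.0ℤ × w ≢ ℤ.0ℤ
             × a ℤ.* u ℤ.^ ℓ ℤ.+ b ℤ.* v ℤ.^ ℓ ℤ.+ c ℤ.* w ℤ.^ ℓ ≡ ℤ.0ℤ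
             × PowerFree ℓ a × PowerFree ℓ b × PowerFree ℓ c
             × PrimeDivisorsAtMost k (a ℤ.* b ℤ.* c)
             × ¬ (p ∣ ∣ a ℤ.* b ℤ.* c ∣)
             × ( (p ∣ ∣ u ∣ × ¬ (p ∣ ∣ v ∣) × ¬ (p ∣ ∣ w ∣))
               ⊎ (¬ (p ∣ ∣ u ∣) × p ∣ ∣ v ∣ × ¬ (p ∣ ∣ w ∣))
               ⊎ (¬ (p ∣ ∣ u ∣) × ¬ (p ∣ ∣ v ∣) × p ∣ ∣ w ∣) ) )
lemma2p1 k ℓ 2≤k ℓ-prime k<ℓ (mkℚ n d n⊥s) y@(mkℚ r e r⊥t) y≢0 x↑k≡y^ℓ p p-prime k<2p p≤k
  with splitClearedEquation k ℓ n (suc d) r (suc e) (Coprime.recompute n⊥s) (Coprime.recompute r⊥t)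
         (ℕ.≢-nonZero⁻¹ _ {{m^n≢0 (suc e) ℓ}})
         (risingProd≡^⇒ n d n⊥s r e r⊥t k ℓ x↑k≡y^ℓ)
... | s^k≡t^ℓ , ∣∏∣≡∣r∣^ℓ with ^≡^⇒∃^ k ℓ {{prime⇒nonZero ℓ-prime}} (suc d) (suc e) k⊥ℓ (λ ()) (λ ()) s^k≡t^ℓ
  where
  k⊥ℓ : Coprime k ℓ
  k⊥ℓ = Coprime.sym (prime⇒coprime ℓ-prime {{ℕ.>-nonZero (<-trans ℕ.z<s 2≤k)}} k<ℓ)
... | D , s≡D^ℓ = PowerProgression.ternaryEquation k ℓ {{prime⇒nonZero ℓ-prime}} 2≤k k<ℓ
                    n (suc d) (Coprime.recompute n⊥s) D s≡D^ℓ ∣ r ∣ ∣r∣≢0 ∣∏∣≡∣r∣^ℓ p p-prime k<2p p≤k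
  where
  ∣r∣≢0 : ∣ r ∣ ≢ 0
  ∣r∣≢0 ∣r∣≡0 = y≢0 (↥p≡0⇒p≡0 y (∣i∣≡0⇒i≡0 ∣r∣≡0))
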